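{- Let $G=DS(L,P^{core},R)$ be a double spider and suppose some path $P$ of length one belongs to $L\cup R$. Assume at least one of the following holds: (1) $P\in R$, $\deg_G(v_l)\geq\deg_G(v_r)>3$, and the double spider $DS(L,P^{core},R\setminus\{P\})$ (obtained from $G$ by deleting the leaf of $P$) is strongly antimagic; (2) $P\in L$, $\deg_G(v_l)>\deg_G(v_r)\geq 3$, and the double spider $DS(L\setminus\{P\},P^{core},R)$ (obtained from $G$ by deleting the leaf of $P$) has a strongly antimagic labeling $f$ with $\varphi_f(v_l)>\varphi_f(v_r)$. Then $G$ is strongly antimagic.
   Context: A double spider is a tree with exactly two vertices of degree greater than 2. Its edge set decomposes as follows: $P^{core}$ is the unique path joining the two vertices of degree at least 3, whose endpoints are denoted $v_l$ and $v_r$; $L$ is the set of paths having one endpoint at $v_l$ whose union with $P^{core}$ and $R$ gives the tree (i.e. the legs hanging at $v_l$, edge-disjoint from $P^{core}$), and $R$ is the analogous set of paths having one endpoint at $v_r$. The notation $DS(L,P^{core},R)$ denotes this double spider; by convention $L$ contains at least as many paths as $R$, so $\deg(v_l)\ge\deg(v_r)$. The length of a path is its number of edges. For a graph with edge set $E$ and a bijection $f:E\to\{1,\dots,|E|\}$, $\varphi_f(u)=\sum_{e\ni u}f(e)$; $f$ is strongly antimagic if all $\varphi_f(u)$ are distinct and $\deg(u)<\deg(v)$ implies $\varphi_f(u)<\varphi_f(v)$. A graph is strongly antimagic if it has such a labeling. -}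

module Defs where

open import Data.Nat using (ℕ; zero; suc; _+_; _∸_; _<_; _≤_)
open import Data.Nat.Properties using (_≟_)
open import Data.Fin using (Fin; toℕ)
open import Data.List using (List; []; _∷_; _++_; length; map; lookup; allFin)
open import Data.Nat.ListAction using (sum)
open import Data.List.Relation.Unary.All using (All)
open import Data.Product using (_×_; _,_; Σ; ∃)
open import Function.Bundles using (_⤖_; Bijection)
open import Relation.Binary.PropositionalEquality using (_≡_)
open import Relation.Nullary.Decidable using (⌊_⌋)
open import Data.Bool using (Bool; true; false; if_then_else_; _∨_)

-- Finite simple graphs given by an edge list on vertex set {0,…,n-1}.

Edge : Set
Edge = ℕ × ℕ

incident : ℕ → Edge → Bool
incident u (a , b) = ⌊ u ≟ a ⌋ ∨ ⌊ u ≟ b ⌋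

deg : List Edge → ℕ → ℕ
deg es u = sum (map (λ e → if incident u e then 1 else 0) es)

EdgeIx : List Edge → Set
EdgeIx es = Fin (length es)

-- label of edge i under bijection f : E → {1,…,|E|}  (Fin |E| shifted by one)
label : (es : List Edge) → (EdgeIx es ⤖ EdgeIx es) → EdgeIx es → ℕ
label es f i = suc (toℕ (Bijection.to f i))

φ : (es : List Edge) → (EdgeIx es ⤖ EdgeIx es) → ℕ → ℕ
φ es f u = sum (map (λ i → if incident u (lookup es i) then label es f i else 0)
                    (allFin (length es)))

IsStronglyAntimagicLabeling : ℕ → (es : List Edge) → (EdgeIx es ⤖ EdgeIx es) → Set
IsStronglyAntimagicLabeling n es f =
  (∀ u v → u < n → v < n → φ es f u ≡ φ es f v → u ≡ v)
  × (∀ u v → u < n → v < n → deg es u < deg es v → φ es f u < φ es f v)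

StronglyAntimagic : ℕ → List Edge → Set
StronglyAntimagic n es = Σ (EdgeIx es ⤖ EdgeIx es) (IsStronglyAntimagicLabeling n es)

-- Double spiders DS(L, P^core, R).
-- L, R : lists of leg lengths; c : length of the core path.
-- Vertex 0 is v_l, vertex 1 is v_r; fresh vertices are numbered from 2.

path : ℕ → ℕ → ℕ → List Edge
path a s zero    = []
path a s (suc k) = (a , s) ∷ path s (suc s) k

pathTo : ℕ → ℕ → ℕ → ℕ → List Edge
pathTo a s zero    b = (a , b) ∷ []
pathTo a s (suc k) b = (a , s) ∷ pathTo s (suc s) k b

legs : ℕ → ℕ → List ℕ → List Edge
legs a s []       = []
legs a s (ℓ ∷ ls) = path a s ℓ ++ legs a (s + ℓ) ls

dsVertices : List ℕ → ℕ → List ℕ → ℕ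
dsVertices L c R = 2 + (c ∸ 1) + sum L + sum R

dsEdges : List ℕ → ℕ → List ℕ → List Edge
dsEdges L c R =
  pathTo 0 2 (c ∸ 1) 1
  ++ legs 0 (2 + (c ∸ 1)) L
  ++ legs 1 (2 + (c ∸ 1) + sum L) R

-- (L, c, R) describes a double spider with the convention |L| ≥ |R|
-- (deg v_l = |L|+1 ≥ deg v_r = |R|+1 ≥ 3, all paths of length ≥ 1).
IsDoubleSpider : List ℕ → ℕ → List ℕ → Set
IsDoubleSpider L c R =
  1 ≤ c × All (1 ≤_) L × All (1 ≤_) R
  × 2 ≤ length R × length R ≤ length L

v-l v-r : ℕ
v-l = 0
v-r = 1

module Submission where

-- Give the new pendant edge at p the label 1 and raise every old label by one.  An old vertex
-- u then weighs φ(u) + deg(u), plus 1 if u = p, and the new leaf weighs 1.  Adding the degree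
-- to the weight keeps a strongly antimagic labeling strongly antimagic, and the extra 1 at p
-- does no harm as long as p outweighs every other vertex of degree at most deg p: a vertex of
-- larger degree gains both in φ and in deg.  In a double spider every vertex other than v_l
-- and v_r has degree at most 2, so with p = v_r this follows from deg v_l > deg v_r ≥ 3, and
-- with p = v_l from the assumption φ(v_l) > φ(v_r).

open import Defs
open import Data.Nat using (ℕ; zero; suc; _+_; _∸_; _<_; _≤_; _>_; _≥_; z≤n; s≤s)
open import Data.Nat.Properties
open import Data.Nat.ListAction using (sum)
open import Data.Nat.ListAction.Properties using (sum-++; sum-↭)
open import Data.Fin using (Fin; cast) renaming (zero to fzero; suc to fsuc)
open import Data.Fin.Properties using (toℕ-cast)
open import Data.Fin.Permutation using (Permutation; _⟨$⟩ʳ_; _∘ₚ_; cast-id; lift₀)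
open import Data.List using (List; []; _∷_; _++_; length; map; lookup; tabulate)
open import Data.List.Properties using (map-tabulate; length-map; map-++; ++-assoc)
open import Data.List.Relation.Binary.Permutation.Propositional
  using (_↭_; ↭-sym; ↭⇒↭ₛ; module PermutationReasoning)
open import Data.List.Relation.Binary.Permutation.Propositional.Properties
  using (↭-length; map⁺; shift; ++⁺ˡ; ++⁺ʳ)
open import Data.List.Relation.Binary.Permutation.Homogeneous using (onIndices)
import Data.List.Relation.Binary.Permutation.Setoid.Properties as ↭ₛ
open import Data.Product using (Σ; _×_; _,_; proj₁; proj₂)
open import Data.Sum using (_⊎_; inj₁; inj₂)
open import Data.Bool using (true; false; if_then_else_; _∨_)
open import Data.Bool.Properties using (∨-identityʳ; ∨-zeroʳ)
open import Function using (_∘_)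
open import Function.Bundles using (_⤖_; mk⇔)
open import Function.Properties.Bijection using (⤖⇒↔)
open import Function.Properties.Inverse using (↔⇒⤖)
open import Relation.Binary.PropositionalEquality
open import Relation.Binary.Definitions using (tri<; tri≈; tri>)
open import Relation.Nullary using (yes; no)
open import Relation.Nullary.Decidable using (⌊_⌋; isYes≗does; dec-true; dec-false; does-⇔; toSum)
open import Relation.Nullary.Negation using (contradiction)
open import Algebra.Properties.CommutativeMonoid.Sum +-0-commutativeMonoid
  using (sum-permute; sum-cong-≗; ∑-distrib-+) renaming (sum to ∑)

-- Degree and weight functions

-- IsStronglyAntimagicLabeling n es f unfolds to Antimagic n (deg es) (φ es f).
Antimagic : ℕ → (ℕ → ℕ) → (ℕ → ℕ) → Set
Antimagic n d wt =
  (∀ u v → u < n → v < n → wt u ≡ wt v → u ≡ v)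
  × (∀ u v → u < n → v < n → d u < d v → wt u < wt v)

Antimagic-cong : ∀ {n d d′ wt wt′} → d ≗ d′ → wt ≗ wt′ → Antimagic n d wt → Antimagic n d′ wt′
Antimagic-cong d≗d′ wt≗wt′ (inj , mono) =
  (λ u v u<n v<n eq → inj u v u<n v<n (trans (wt≗wt′ u) (trans eq (sym (wt≗wt′ v)))))
  , λ u v u<n v<n lt → subst₂ _<_ (wt≗wt′ u) (wt≗wt′ v)
      (mono u v u<n v<n (subst₂ _<_ (sym (d≗d′ u)) (sym (d≗d′ v)) lt))

Antimagic-+deg : ∀ {n d wt} → Antimagic n d wt → Antimagic n d (λ u → wt u + d u)
Antimagic-+deg {n} {d} {wt} (inj , mono) = inj′ , mono′
  where
  mono′ : ∀ u v → u < n → v < n → d u < d v → wt u + d u < wt v + d v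
  mono′ u v u<n v<n lt = +-mono-< (mono u v u<n v<n lt) lt
  inj′ : ∀ u v → u < n → v < n → wt u + d u ≡ wt v + d v → u ≡ v
  inj′ u v u<n v<n eq with <-cmp (d u) (d v)
  ... | tri< lt _ _ = contradiction eq (<⇒≢ (mono′ u v u<n v<n lt))
  ... | tri≈ _ du≡dv _ = inj u v u<n v<n (+-cancelʳ-≡ (d v) _ _ (subst (λ x → wt u + x ≡ wt v + d v) du≡dv eq))
  ... | tri> _ _ gt = contradiction (sym eq) (<⇒≢ (mono′ v u v<n u<n gt))

δ : ℕ → ℕ → ℕ
δ p u = if ⌊ u ≟ p ⌋ then 1 else 0

δ-refl : ∀ p → δ p p ≡ 1
δ-refl p = cong (if_then 1 else 0) (trans (isYes≗does (p ≟ p)) (dec-true (p ≟ p) refl))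

δ-≢ : ∀ {p u} → u ≢ p → δ p u ≡ 0
δ-≢ {p} {u} u≢p = cong (if_then 1 else 0) (trans (isYes≗does (u ≟ p)) (dec-false (u ≟ p) u≢p))

-- The old vertices after attaching a pendant edge labelled 1 at p and raising the old labels.
Antimagic-attach : ∀ {n d wt p} → Antimagic n d wt → p < n
  → (∀ w → w < n → w ≢ p → d w ≤ d p → wt w < wt p)
  → Antimagic n (λ u → δ p u + d u) (λ u → δ p u + (wt u + d u))
Antimagic-attach {n} {d} {wt} {p} am p<n p-max = inj′ , mono′
  where
  χ : ℕ → ℕ
  χ u = wt u + d u

  below-p : ∀ {w} → w < n → w ≢ p → d w ≤ d p → χ w < suc (χ p)
  below-p w<n w≢p le = s≤s (+-mono-≤ (<⇒≤ (p-max _ w<n w≢p le)) le)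

  above-p : ∀ {w} → w < n → d p < d w → suc (χ p) < χ w
  above-p {w} w<n lt = subst (_≤ χ w) (+-suc (suc (wt p)) (d p)) (+-mono-≤ (proj₂ am p w p<n w<n lt) lt)

  χ≢suc-χp : ∀ {w} → w < n → w ≢ p → χ w ≢ suc (χ p)
  χ≢suc-χp {w} w<n w≢p with ≤-<-connex (d w) (d p)
  ... | inj₁ le = <⇒≢ (below-p w<n w≢p le)
  ... | inj₂ lt = ≢-sym (<⇒≢ (above-p w<n lt))

  -- Splitting on u ≟ p also evaluates δ p u in the goal.
  inj′ : ∀ u v → u < n → v < n → δ p u + χ u ≡ δ p v + χ v → u ≡ v
  inj′ u v u<n v<n eq with u ≟ p | v ≟ p
  ... | yes refl | yes refl = refl
  ... | yes refl | no v≢p = contradiction (sym eq) (χ≢suc-χp v<n v≢p)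
  ... | no u≢p | yes refl = contradiction eq (χ≢suc-χp u<n u≢p)
  ... | no u≢p | no v≢p = proj₁ (Antimagic-+deg am) u v u<n v<n eq

  mono′ : ∀ u v → u < n → v < n → δ p u + d u < δ p v + d v → δ p u + χ u < δ p v + χ v
  mono′ u v u<n v<n lt with u ≟ p | v ≟ p
  ... | yes refl | yes refl = contradiction lt (<-irrefl refl)
  ... | yes refl | no v≢p = above-p v<n (<⇒≤ lt)
  ... | no u≢p | yes refl = below-p u<n u≢p (≤-pred lt)
  ... | no u≢p | no v≢p = proj₂ (Antimagic-+deg am) u v u<n v<n lt

-- The ℕ analogue of Fin.punchIn: renumbers the old vertices around a fresh vertex s.
skip : ℕ → ℕ → ℕ
skip s v with v <? s
... | yes _ = v
... | no _ = suc v

skip-< : ∀ {s v} → v < s → skip s v ≡ v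
skip-< {s} {v} v<s with v <? s
... | yes _ = refl
... | no v≮s = contradiction v<s v≮s

skip-≥ : ∀ {s v} → s ≤ v → skip s v ≡ suc v
skip-≥ {s} {v} s≤v with v <? s
... | yes v<s = contradiction s≤v (<⇒≱ v<s)
... | no _ = refl

skip-≢ : ∀ s v → skip s v ≢ s
skip-≢ s v with v <? s
... | yes v<s = <⇒≢ v<s
... | no v≮s = λ eq → v≮s (≤-reflexive eq)

skip-injective : ∀ s {u v} → skip s u ≡ skip s v → u ≡ v
skip-injective s {u} {v} eq with u <? s | v <? s
... | yes _ | yes _ = eq
... | no _ | no _ = suc-injective eq
... | yes u<s | no v≮s = contradiction (<-trans (n<1+n v) (subst (_< s) eq u<s)) v≮s
... | no u≮s | yes v<s = contradiction (<-trans (n<1+n u) (subst (_< s) (sym eq) v<s)) u≮s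

data SkipView (n s : ℕ) : ℕ → Set where
  hole : SkipView n s s
  old  : ∀ {u} → u < n → SkipView n s (skip s u)

skipView : ∀ {n s} v → s ≤ n → v < suc n → SkipView n s v
skipView {n} {s} v s≤n v<1+n with <-cmp v s
... | tri< v<s _ _ = subst (SkipView n s) (skip-< v<s) (old (<-≤-trans v<s s≤n))
... | tri≈ _ refl _ = hole
skipView {n} {s} (suc u) s≤n (s≤s u<n) | tri> _ _ (s≤s s≤u) = subst (SkipView n s) (skip-≥ s≤u) (old u<n)

Antimagic-insert : ∀ {n s d wt} → s ≤ n → Antimagic n (d ∘ skip s) (wt ∘ skip s)
  → d s ≡ 1 → wt s ≡ 1
  → (∀ v → d v ≤ wt v) → (∀ v → d v ≡ 0 → wt v ≡ 0) → (∀ u → wt (skip s u) ≢ 1)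
  → Antimagic (suc n) d wt
Antimagic-insert {n} {s} {d} {wt} s≤n (inj , mono) ds≡1 wts≡1 d≤wt isolated wt≢1 = inj′ , mono′
  where
  inj′ : ∀ u v → u < suc n → v < suc n → wt u ≡ wt v → u ≡ v
  inj′ u v u<n v<n eq with skipView u s≤n u<n | skipView v s≤n v<n
  ... | hole | hole = refl
  ... | hole | old {b} _ = contradiction (trans (sym eq) wts≡1) (wt≢1 b)
  ... | old {a} _ | hole = contradiction (trans eq wts≡1) (wt≢1 a)
  ... | old {a} a<n | old {b} b<n = cong (skip s) (inj a b a<n b<n eq)

  mono′ : ∀ u v → u < suc n → v < suc n → d u < d v → wt u < wt v
  mono′ u v u<n v<n lt with skipView u s≤n u<n | skipView v s≤n v<n
  ... | hole | hole = contradiction lt (<-irrefl refl)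
  ... | hole | old _ = subst (_< wt _) (sym wts≡1) (<-≤-trans (subst (_< d _) ds≡1 lt) (d≤wt _))
  ... | old _ | hole =
    subst₂ _<_ (sym (isolated _ (n<1⇒n≡0 (subst (d _ <_) ds≡1 lt)))) (sym wts≡1) (s≤s z≤n)
  ... | old {a} a<n | old {b} b<n = mono a b a<n b<n lt

-- Sums over incident edges

incidentSum : (es : List Edge) → ℕ → (EdgeIx es → ℕ) → ℕ
incidentSum es u h = ∑ (λ i → if incident u (lookup es i) then h i else 0)

sum-tabulate : ∀ {n} (h : Fin n → ℕ) → sum (tabulate h) ≡ ∑ h
sum-tabulate {zero}  h = refl
sum-tabulate {suc n} h = cong (h fzero +_) (sum-tabulate (h ∘ fsuc))

φ≡incidentSum : ∀ es f u → φ es f u ≡ incidentSum es u (label es f)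
φ≡incidentSum es f u = trans (cong sum (map-tabulate {n = length es} (λ i → i) _)) (sum-tabulate {length es} _)

deg≡incidentSum : ∀ es u → deg es u ≡ incidentSum es u (λ _ → 1)
deg≡incidentSum []       u = refl
deg≡incidentSum (e ∷ es) u = cong (_ +_) (deg≡incidentSum es u)

incidentSum-cong : ∀ es u {g h} → (∀ i → g i ≡ h i) → incidentSum es u g ≡ incidentSum es u h
incidentSum-cong es u g≡h =
  sum-cong-≗ {length es} (λ i → cong (if incident u (lookup es i) then_else 0) (g≡h i))

incidentSum-mono : ∀ es u {g h} → (∀ i → g i ≤ h i) → incidentSum es u g ≤ incidentSum es u h
incidentSum-mono []       u g≤h = z≤n
incidentSum-mono (e ∷ es) u g≤h with incident u e
... | true  = +-mono-≤ (g≤h fzero) (incidentSum-mono es u (g≤h ∘ fsuc))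
... | false = incidentSum-mono es u (g≤h ∘ fsuc)

incidentSum-isolated : ∀ es u h → incidentSum es u (λ _ → 1) ≡ 0 → incidentSum es u h ≡ 0
incidentSum-isolated []       u h _  = refl
incidentSum-isolated (e ∷ es) u h eq with incident u e
... | true  = contradiction eq λ ()
... | false = incidentSum-isolated es u (h ∘ fsuc) eq

incidentSum-suc : ∀ es u h → incidentSum es u (suc ∘ h) ≡ incidentSum es u h + incidentSum es u (λ _ → 1)
incidentSum-suc es u h = trans (sum-cong-≗ split) (∑-distrib-+ {length es} _ _)
  where
  split : ∀ i → (if incident u (lookup es i) then suc (h i) else 0)
              ≡ (if incident u (lookup es i) then h i else 0) + (if incident u (lookup es i) then 1 else 0)
  split i with incident u (lookup es i)
  ... | true  = +-comm 1 (h i)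
  ... | false = refl

deg≤φ : ∀ es f u → deg es u ≤ φ es f u
deg≤φ es f u = subst₂ _≤_ (sym (deg≡incidentSum es u)) (sym (φ≡incidentSum es f u))
  (incidentSum-mono es u (λ _ → s≤s z≤n))

φ-isolated : ∀ es f u → deg es u ≡ 0 → φ es f u ≡ 0
φ-isolated es f u d≡0 = trans (φ≡incidentSum es f u)
  (incidentSum-isolated es u _ (trans (sym (deg≡incidentSum es u)) d≡0))

module _ {xs ys : List Edge} (xs↭ys : xs ↭ ys) where

  private
    π : Permutation (length ys) (length xs)
    π = onIndices (↭⇒↭ₛ (↭-sym xs↭ys))

    lookup-π : ∀ j → lookup ys j ≡ lookup xs (π ⟨$⟩ʳ j)
    lookup-π = ↭ₛ.onIndices-lookup (setoid Edge) (↭⇒↭ₛ (↭-sym xs↭ys))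

  relabel : (EdgeIx xs ⤖ EdgeIx xs) → EdgeIx ys ⤖ EdgeIx ys
  relabel f = ↔⇒⤖ (π ∘ₚ ⤖⇒↔ f ∘ₚ cast-id (↭-length xs↭ys))

  φ-relabel : ∀ f u → φ ys (relabel f) u ≡ φ xs f u
  φ-relabel f u = begin
    φ ys (relabel f) u
      ≡⟨ φ≡incidentSum ys (relabel f) u ⟩
    ∑ (λ j → if incident u (lookup ys j) then label ys (relabel f) j else 0)
      ≡⟨ sum-cong-≗ (λ j → cong₂ (λ e l → if incident u e then l else 0)
           (lookup-π j) (cong suc (toℕ-cast (↭-length xs↭ys) _))) ⟩
    ∑ (λ j → g (π ⟨$⟩ʳ j))
      ≡⟨ sum-permute g π ⟨
    ∑ g
      ≡⟨ φ≡incidentSum xs f u ⟨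
    φ xs f u ∎
    where
    open ≡-Reasoning
    g : EdgeIx xs → ℕ
    g i = if incident u (lookup xs i) then label xs f i else 0

  deg-↭ : ∀ u → deg xs u ≡ deg ys u
  deg-↭ u = sum-↭ (map⁺ _ xs↭ys)

StronglyAntimagic-↭ : ∀ {n xs ys} → xs ↭ ys → StronglyAntimagic n xs → StronglyAntimagic n ys
StronglyAntimagic-↭ xs↭ys (f , am) =
  relabel xs↭ys f , Antimagic-cong (deg-↭ xs↭ys) (λ u → sym (φ-relabel xs↭ys f u)) am

-- Attaching a pendant edge

skipE : ℕ → Edge → Edge
skipE s (a , b) = skip s a , skip s b

⌊≟⌋-true : ∀ {x y} → x ≡ y → ⌊ x ≟ y ⌋ ≡ true
⌊≟⌋-true {x} {y} x≡y = trans (isYes≗does (x ≟ y)) (dec-true (x ≟ y) x≡y)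

⌊≟⌋-false : ∀ {x y} → x ≢ y → ⌊ x ≟ y ⌋ ≡ false
⌊≟⌋-false {x} {y} x≢y = trans (isYes≗does (x ≟ y)) (dec-false (x ≟ y) x≢y)

⌊≟⌋-skip : ∀ s x y → ⌊ skip s x ≟ skip s y ⌋ ≡ ⌊ x ≟ y ⌋
⌊≟⌋-skip s x y = trans (isYes≗does (skip s x ≟ skip s y))
  (trans (does-⇔ (mk⇔ (skip-injective s) (cong (skip s))) (skip s x ≟ skip s y) (x ≟ y))
         (sym (isYes≗does (x ≟ y))))

incident-skip : ∀ s u e → incident (skip s u) (skipE s e) ≡ incident u e
incident-skip s u (a , b) = cong₂ _∨_ (⌊≟⌋-skip s u a) (⌊≟⌋-skip s u b)

incident-hole : ∀ s e → incident s (skipE s e) ≡ false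
incident-hole s (a , b) = cong₂ _∨_ (⌊≟⌋-false (skip-≢ s a ∘ sym)) (⌊≟⌋-false (skip-≢ s b ∘ sym))

incidentSum-skip : ∀ s es u (g : EdgeIx es → ℕ) →
  incidentSum (map (skipE s) es) (skip s u) (g ∘ cast (length-map (skipE s) es)) ≡ incidentSum es u g
incidentSum-skip s []       u g = refl
incidentSum-skip s (e ∷ es) u g =
  cong₂ _+_ (cong (if_then g fzero else 0) (incident-skip s u e)) (incidentSum-skip s es u (g ∘ fsuc))

incidentSum-hole : ∀ s es h → incidentSum (map (skipE s) es) s h ≡ 0
incidentSum-hole s []       h = refl
incidentSum-hole s (e ∷ es) h =
  cong₂ _+_ (cong (if_then h fzero else 0) (incident-hole s e)) (incidentSum-hole s es (h ∘ fsuc))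

m+n≢1 : ∀ {m n} → n ≤ m → (n ≡ 0 → m ≡ 0) → m + n ≢ 1
m+n≢1 {m} {zero} _ n≡0⇒m≡0 eq = 0≢1+n (trans (sym (n≡0⇒m≡0 refl)) (trans (sym (+-identityʳ m)) eq))
m+n≢1 {suc m} {suc n} _ _ eq = 1+n≢0 (trans (sym (+-suc m n)) (suc-injective eq))

module Pendant (s p : ℕ) (es : List Edge) where

  G : List Edge
  G = (skip s p , s) ∷ map (skipE s) es

  private
    lm : length (map (skipE s) es) ≡ length es
    lm = length-map (skipE s) es

  -- Label 1 on the new edge, every old label raised by one.
  shifted : (EdgeIx es ⤖ EdgeIx es) → EdgeIx G ⤖ EdgeIx G
  shifted f = ↔⇒⤖ (lift₀ (cast-id lm ∘ₚ ⤖⇒↔ f ∘ₚ cast-id (sym lm)))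

  incident-pendant : ∀ u → incident (skip s u) (skip s p , s) ≡ ⌊ u ≟ p ⌋
  incident-pendant u = trans (cong₂ _∨_ (⌊≟⌋-skip s u p) (⌊≟⌋-false (skip-≢ s u))) (∨-identityʳ _)

  incident-pendant-hole : incident s (skip s p , s) ≡ true
  incident-pendant-hole = trans (cong (⌊ s ≟ skip s p ⌋ ∨_) (⌊≟⌋-true {s} refl)) (∨-zeroʳ _)

  deg-skip : ∀ u → deg G (skip s u) ≡ δ p u + deg es u
  deg-skip u = cong₂ _+_ (cong (if_then 1 else 0) (incident-pendant u)) (begin
    deg (map (skipE s) es) (skip s u)                   ≡⟨ deg≡incidentSum (map (skipE s) es) (skip s u) ⟩
    incidentSum (map (skipE s) es) (skip s u) (λ _ → 1) ≡⟨ incidentSum-skip s es u (λ _ → 1) ⟩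
    incidentSum es u (λ _ → 1)                          ≡⟨ deg≡incidentSum es u ⟨
    deg es u                                            ∎)
    where open ≡-Reasoning

  φ-skip : ∀ f u → φ G (shifted f) (skip s u) ≡ δ p u + (φ es f u + deg es u)
  φ-skip f u = trans (φ≡incidentSum G (shifted f) (skip s u))
    (cong₂ _+_ (cong (if_then 1 else 0) (incident-pendant u)) (begin
      incidentSum (map (skipE s) es) (skip s u) (label G (shifted f) ∘ fsuc)
        ≡⟨ incidentSum-cong (map (skipE s) es) (skip s u) (λ i → cong (suc ∘ suc) (toℕ-cast (sym lm) _)) ⟩
      incidentSum (map (skipE s) es) (skip s u) ((suc ∘ label es f) ∘ cast lm)
        ≡⟨ incidentSum-skip s es u (suc ∘ label es f) ⟩
      incidentSum es u (suc ∘ label es f)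
        ≡⟨ incidentSum-suc es u (label es f) ⟩
      incidentSum es u (label es f) + incidentSum es u (λ _ → 1)
        ≡⟨ cong₂ _+_ (φ≡incidentSum es f u) (deg≡incidentSum es u) ⟨
      φ es f u + deg es u ∎))
    where open ≡-Reasoning

  deg-hole : deg G s ≡ 1
  deg-hole = cong₂ _+_ (cong (if_then 1 else 0) incident-pendant-hole)
    (trans (deg≡incidentSum (map (skipE s) es) s) (incidentSum-hole s es _))

  φ-hole : ∀ f → φ G (shifted f) s ≡ 1
  φ-hole f = trans (φ≡incidentSum G (shifted f) s)
    (cong₂ _+_ (cong (if_then 1 else 0) incident-pendant-hole) (incidentSum-hole s es (label G (shifted f) ∘ fsuc)))

  φ-skip-≢1 : ∀ f → 1 ≤ deg es p → ∀ u → φ G (shifted f) (skip s u) ≢ 1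
  φ-skip-≢1 f 1≤dp u eq with u ≟ p | trans (sym (φ-skip f u)) eq
  ... | yes refl | eq′ = contradiction (m+n≡0⇒n≡0 (φ es f u) (suc-injective eq′)) (n>0⇒n≢0 1≤dp)
  ... | no _     | eq′ = m+n≢1 (deg≤φ es f u) (φ-isolated es f u) eq′

StronglyAntimagic-pendant : ∀ {n es} (f : EdgeIx es ⤖ EdgeIx es) → IsStronglyAntimagicLabeling n es f
  → ∀ {s p} → s ≤ n → p < n → 1 ≤ deg es p
  → (∀ w → w < n → w ≢ p → deg es w ≤ deg es p → φ es f w < φ es f p)
  → StronglyAntimagic (suc n) ((skip s p , s) ∷ map (skipE s) es)
StronglyAntimagic-pendant {es = es} f am {s} {p} s≤n p<n 1≤dp p-max = shifted f ,
  Antimagic-insert s≤n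
    (Antimagic-cong (sym ∘ deg-skip) (sym ∘ φ-skip f) (Antimagic-attach am p<n p-max))
    deg-hole (φ-hole f) (deg≤φ G (shifted f)) (φ-isolated G (shifted f)) (φ-skip-≢1 f 1≤dp)
  where open Pendant s p es

StronglyAntimagic-addLeaf : ∀ {n G G′ s p} (f : EdgeIx G′ ⤖ EdgeIx G′) → IsStronglyAntimagicLabeling n G′ f
  → s ≤ n → p < n → 1 ≤ deg G′ p
  → (∀ w → w < n → w ≢ p → deg G′ w ≤ deg G′ p → φ G′ f w < φ G′ f p)
  → G ↭ (skip s p , s) ∷ map (skipE s) G′ → StronglyAntimagic (suc n) G
StronglyAntimagic-addLeaf {G′ = G′} f am s≤n p<n 1≤dp p-max G↭ =
  StronglyAntimagic-↭ (↭-sym G↭) (StronglyAntimagic-pendant {es = G′} f am s≤n p<n 1≤dp p-max)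

deg-addLeaf : ∀ {G G′ s p} → G ↭ (skip s p , s) ∷ map (skipE s) G′
  → ∀ {v} → v < s → deg G v ≡ δ p v + deg G′ v
deg-addLeaf {G} {G′} {s} {p} G↭ {v} v<s = begin
  deg G v                                            ≡⟨ cong (deg G) (skip-< v<s) ⟨
  deg G (skip s v)                                   ≡⟨ deg-↭ G↭ (skip s v) ⟩
  deg ((skip s p , s) ∷ map (skipE s) G′) (skip s v) ≡⟨ Pendant.deg-skip s p G′ v ⟩
  δ p v + deg G′ v                                   ∎
  where open ≡-Reasoning

-- Double spiders

deg-++ : ∀ xs ys w → deg (xs ++ ys) w ≡ deg xs w + deg ys w
deg-++ xs ys w = trans (cong sum (map-++ _ xs ys)) (sum-++ (map _ xs) (map _ ys))

deg-∷-≢ : ∀ {a b} es w → w ≢ a → w ≢ b → deg ((a , b) ∷ es) w ≡ deg es w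
deg-∷-≢ es w w≢a w≢b =
  cong (λ x → (if x then 1 else 0) + deg es w) (cong₂ _∨_ (⌊≟⌋-false w≢a) (⌊≟⌋-false w≢b))

deg-∷-fst : ∀ {b} es w → deg ((w , b) ∷ es) w ≡ suc (deg es w)
deg-∷-fst {b} es w = cong (λ x → (if x ∨ ⌊ w ≟ b ⌋ then 1 else 0) + deg es w) (⌊≟⌋-true {w} refl)

deg-∷-snd : ∀ {a} es w → deg ((a , w) ∷ es) w ≡ suc (deg es w)
deg-∷-snd {a} es w =
  cong (λ x → (if x then 1 else 0) + deg es w)
       (trans (cong (⌊ w ≟ a ⌋ ∨_) (⌊≟⌋-true {w} refl)) (∨-zeroʳ _))

≤-peel : ∀ {t k s} → t + suc k ≤ s → t < s × suc t + k ≤ s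
≤-peel {t} {k} {s} t+1+k≤s = ≤-trans (s≤s (m≤m+n t k)) 1+t+k≤s , 1+t+k≤s
  where
  1+t+k≤s : suc t + k ≤ s
  1+t+k≤s = subst (_≤ s) (+-suc t k) t+1+k≤s

≤-split : ∀ {t ℓ m s} → t + (ℓ + m) ≤ s → t + ℓ ≤ s × t + ℓ + m ≤ s
≤-split {t} {ℓ} {m} {s} t+ℓ+m≤s =
  ≤-trans (+-monoʳ-≤ t (m≤m+n ℓ m)) t+ℓ+m≤s , subst (_≤ s) (sym (+-assoc t ℓ m)) t+ℓ+m≤s

Outside : ℕ → ℕ → ℕ → Set
Outside w t k = w < t ⊎ t + k ≤ w

outside-head : ∀ {w t k} → Outside w t (suc k) → w ≢ t
outside-head (inj₁ w<t) = <⇒≢ w<t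
outside-head (inj₂ t+k<w) = ≢-sym (<⇒≢ (proj₁ (≤-peel t+k<w)))

outside-tail : ∀ {w t k} → Outside w t (suc k) → Outside w (suc t) k
outside-tail (inj₁ w<t) = inj₁ (m<n⇒m<1+n w<t)
outside-tail (inj₂ t+k<w) = inj₂ (proj₂ (≤-peel t+k<w))

outside-++ : ∀ {w t ℓ m} → Outside w t (ℓ + m) → Outside w t ℓ × Outside w (t + ℓ) m
outside-++ {t = t} {ℓ} (inj₁ w<t) = inj₁ w<t , inj₁ (<-≤-trans w<t (m≤m+n t ℓ))
outside-++ {t = t} {ℓ} {m} (inj₂ t+ℓ+m≤w) =
  inj₂ (proj₁ (≤-split {t} {ℓ} {m} t+ℓ+m≤w)) , inj₂ (proj₂ (≤-split {t} {ℓ} {m} t+ℓ+m≤w))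

path-outside : ∀ {w} a t k → w ≢ a → Outside w t k → deg (path a t k) w ≡ 0
path-outside a t zero    _   _   = refl
path-outside a t (suc k) w≢a out =
  trans (deg-∷-≢ (path t (suc t) k) _ w≢a (outside-head out))
        (path-outside t (suc t) k (outside-head out) (outside-tail out))

pathTo-outside : ∀ {w} a t k b → w ≢ a → w ≢ b → Outside w t k → deg (pathTo a t k b) w ≡ 0
pathTo-outside a t zero    b w≢a w≢b _   = deg-∷-≢ [] _ w≢a w≢b
pathTo-outside a t (suc k) b w≢a w≢b out =
  trans (deg-∷-≢ (pathTo t (suc t) k b) _ w≢a (outside-head out))
        (pathTo-outside t (suc t) k b (outside-head out) w≢b (outside-tail out))

legs-outside : ∀ {w} a t ls → w ≢ a → Outside w t (sum ls) → deg (legs a t ls) w ≡ 0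
legs-outside a t []       _   _   = refl
legs-outside {w} a t (ℓ ∷ ls) w≢a out = trans (deg-++ (path a t ℓ) (legs a (t + ℓ) ls) w)
  (cong₂ _+_ (path-outside a t ℓ w≢a (proj₁ (outside-++ out)))
             (legs-outside a (t + ℓ) ls w≢a (proj₂ (outside-++ out))))

path-anchor : ∀ a t k → a < t → deg (path a t k) a ≤ 1
path-anchor a t zero    _   = z≤n
path-anchor a t (suc k) a<t = ≤-reflexive (trans (deg-∷-fst (path t (suc t) k) a)
  (cong suc (path-outside t (suc t) k (<⇒≢ a<t) (inj₁ (m<n⇒m<1+n a<t)))))

pathTo-anchor : ∀ a t k b → a < t → a ≢ b → deg (pathTo a t k b) a ≤ 1
pathTo-anchor a t zero    b _   _   = ≤-reflexive (deg-∷-fst [] a)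
pathTo-anchor a t (suc k) b a<t a≢b = ≤-reflexive (trans (deg-∷-fst (pathTo t (suc t) k b) a)
  (cong suc (pathTo-outside t (suc t) k b (<⇒≢ a<t) a≢b (inj₁ (m<n⇒m<1+n a<t)))))

path-deg≤2 : ∀ {w} a t k → w ≢ a → deg (path a t k) w ≤ 2
path-deg≤2     a t zero    _   = z≤n
path-deg≤2 {w} a t (suc k) w≢a with toSum (w ≟ t)
... | inj₁ refl = ≤-trans (≤-reflexive (deg-∷-snd (path w (suc w) k) w))
                          (s≤s (path-anchor w (suc w) k (n<1+n w)))
... | inj₂ w≢t  = ≤-trans (≤-reflexive (deg-∷-≢ (path t (suc t) k) _ w≢a w≢t))
                          (path-deg≤2 t (suc t) k w≢t)

pathTo-deg≤2 : ∀ {w} a t k b → w ≢ a → w ≢ b → b < t → deg (pathTo a t k b) w ≤ 2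
pathTo-deg≤2     a t zero    b w≢a w≢b _   = ≤-trans (≤-reflexive (deg-∷-≢ [] _ w≢a w≢b)) z≤n
pathTo-deg≤2 {w} a t (suc k) b w≢a w≢b b<t with toSum (w ≟ t)
... | inj₁ refl = ≤-trans (≤-reflexive (deg-∷-snd (pathTo w (suc w) k b) w))
                          (s≤s (pathTo-anchor w (suc w) k b (n<1+n w) w≢b))
... | inj₂ w≢t  = ≤-trans (≤-reflexive (deg-∷-≢ (pathTo t (suc t) k b) _ w≢a w≢t))
                          (pathTo-deg≤2 t (suc t) k b w≢t w≢b (m<n⇒m<1+n b<t))

legs-deg≤2 : ∀ {w} a t ls → w ≢ a → deg (legs a t ls) w ≤ 2
legs-deg≤2     a t []       _   = z≤n
legs-deg≤2 {w} a t (ℓ ∷ ls) w≢a with w <? t + ℓ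
... | yes w<t+ℓ = subst (_≤ 2) (sym (trans (deg-++ (path a t ℓ) (legs a (t + ℓ) ls) w)
        (trans (cong (deg (path a t ℓ) w +_) (legs-outside a (t + ℓ) ls w≢a (inj₁ w<t+ℓ))) (+-identityʳ _))))
        (path-deg≤2 a t ℓ w≢a)
... | no w≮t+ℓ = subst (_≤ 2) (sym (trans (deg-++ (path a t ℓ) (legs a (t + ℓ) ls) w)
        (cong (_+ deg (legs a (t + ℓ) ls) w) (path-outside a t ℓ w≢a (inj₂ (≮⇒≥ w≮t+ℓ))))))
        (legs-deg≤2 a (t + ℓ) ls w≢a)

deg-dsEdges : ∀ L c R w → deg (dsEdges L c R) w
  ≡ deg (pathTo 0 2 (c ∸ 1) 1) w + (deg (legs 0 (2 + (c ∸ 1)) L) w + deg (legs 1 (2 + (c ∸ 1) + sum L) R) w)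
deg-dsEdges L c R w = trans (deg-++ (pathTo 0 2 (c ∸ 1) 1) _ w)
  (cong (deg (pathTo 0 2 (c ∸ 1) 1) w +_) (deg-++ (legs 0 (2 + (c ∸ 1)) L) _ w))

dsEdges-deg≤2 : ∀ L c R {w} → w ≢ v-l → w ≢ v-r → deg (dsEdges L c R) w ≤ 2
dsEdges-deg≤2 L c R {w} w≢0 w≢1 with w <? 2 + (c ∸ 1) | w <? 2 + (c ∸ 1) + sum L
... | yes w<C | _ = subst (_≤ 2) (sym (deg-dsEdges L c R w)) (on-core
      (pathTo-deg≤2 0 2 (c ∸ 1) 1 w≢0 w≢1 (s≤s (s≤s z≤n)))
      (legs-outside 0 _ L w≢0 (inj₁ w<C))
      (legs-outside 1 _ R w≢1 (inj₁ (<-≤-trans w<C (m≤m+n _ (sum L))))))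
  where
  on-core : ∀ {a b c} → a ≤ 2 → b ≡ 0 → c ≡ 0 → a + (b + c) ≤ 2
  on-core a≤2 refl refl = subst (_≤ 2) (sym (+-identityʳ _)) a≤2
... | no w≮C | yes w<T = subst (_≤ 2) (sym (deg-dsEdges L c R w)) (on-left
      (pathTo-outside 0 2 (c ∸ 1) 1 w≢0 w≢1 (inj₂ (≮⇒≥ w≮C)))
      (legs-deg≤2 0 _ L w≢0)
      (legs-outside 1 _ R w≢1 (inj₁ w<T)))
  where
  on-left : ∀ {a b c} → a ≡ 0 → b ≤ 2 → c ≡ 0 → a + (b + c) ≤ 2
  on-left refl b≤2 refl = subst (_≤ 2) (sym (+-identityʳ _)) b≤2
... | no w≮C | no w≮T = subst (_≤ 2) (sym (deg-dsEdges L c R w)) (on-right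
      (pathTo-outside 0 2 (c ∸ 1) 1 w≢0 w≢1 (inj₂ (≮⇒≥ w≮C)))
      (legs-outside 0 _ L w≢0 (inj₂ (≮⇒≥ w≮T)))
      (legs-deg≤2 1 _ R w≢1))
  where
  on-right : ∀ {a b c} → a ≡ 0 → b ≡ 0 → c ≤ 2 → a + (b + c) ≤ 2
  on-right refl refl c≤2 = c≤2

path-skip-below : ∀ {s} a t k → a < s → t + k ≤ s → map (skipE s) (path a t k) ≡ path a t k
path-skip-below a t zero    _   _     = refl
path-skip-below a t (suc k) a<s t+k≤s with ≤-peel t+k≤s
... | t<s , t+k≤s′ = cong₂ _∷_ (cong₂ _,_ (skip-< a<s) (skip-< t<s)) (path-skip-below t (suc t) k t<s t+k≤s′)

pathTo-skip-below : ∀ {s} a t k b → a < s → b < s → t + k ≤ s → map (skipE s) (pathTo a t k b) ≡ pathTo a t k b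
pathTo-skip-below a t zero    b a<s b<s _     = cong (_∷ []) (cong₂ _,_ (skip-< a<s) (skip-< b<s))
pathTo-skip-below a t (suc k) b a<s b<s t+k≤s with ≤-peel t+k≤s
... | t<s , t+k≤s′ = cong₂ _∷_ (cong₂ _,_ (skip-< a<s) (skip-< t<s)) (pathTo-skip-below t (suc t) k b t<s b<s t+k≤s′)

legs-skip-below : ∀ {s} a t ls → a < s → t + sum ls ≤ s → map (skipE s) (legs a t ls) ≡ legs a t ls
legs-skip-below a t []       _   _      = refl
legs-skip-below a t (ℓ ∷ ls) a<s t+ls≤s with ≤-split {t} {ℓ} {sum ls} t+ls≤s
... | t+ℓ≤s , t+ℓ+ls≤s = trans (map-++ _ (path a t ℓ) _)
  (cong₂ _++_ (path-skip-below a t ℓ a<s t+ℓ≤s) (legs-skip-below a (t + ℓ) ls a<s t+ℓ+ls≤s))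

path-skip-above : ∀ {s} a t k → s ≤ t → map (skipE s) (path a t k) ≡ path (skip s a) (suc t) k
path-skip-above a t zero    _   = refl
path-skip-above {s} a t (suc k) s≤t = cong₂ _∷_ (cong (skip s a ,_) (skip-≥ s≤t))
  (trans (path-skip-above t (suc t) k (m≤n⇒m≤1+n s≤t)) (cong (λ x → path x (suc (suc t)) k) (skip-≥ s≤t)))

legs-skip-above : ∀ {s} a t ls → a < s → s ≤ t → map (skipE s) (legs a t ls) ≡ legs a (suc t) ls
legs-skip-above a t []       _   _   = refl
legs-skip-above a t (ℓ ∷ ls) a<s s≤t = trans (map-++ _ (path a t ℓ) _) (cong₂ _++_
  (trans (path-skip-above a t ℓ s≤t) (cong (λ x → path x (suc t) ℓ) (skip-< a<s)))
  (legs-skip-above a (t + ℓ) ls a<s (≤-trans s≤t (m≤m+n t ℓ))))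

legs-++ : ∀ a t X Y → legs a t (X ++ Y) ≡ legs a t X ++ legs a (t + sum X) Y
legs-++ a t []      Y = cong (λ x → legs a x Y) (sym (+-identityʳ t))
legs-++ a t (ℓ ∷ X) Y = begin
  path a t ℓ ++ legs a (t + ℓ) (X ++ Y)
    ≡⟨ cong (path a t ℓ ++_) (legs-++ a (t + ℓ) X Y) ⟩
  path a t ℓ ++ legs a (t + ℓ) X ++ legs a (t + ℓ + sum X) Y
    ≡⟨ ++-assoc (path a t ℓ) _ _ ⟨
  (path a t ℓ ++ legs a (t + ℓ) X) ++ legs a (t + ℓ + sum X) Y
    ≡⟨ cong (λ x → (path a t ℓ ++ legs a (t + ℓ) X) ++ legs a x Y) (+-assoc t ℓ (sum X)) ⟩
  (path a t ℓ ++ legs a (t + ℓ) X) ++ legs a (t + (ℓ + sum X)) Y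
    ∎
  where open ≡-Reasoning

sum-insert : ∀ X Y → sum (X ++ 1 ∷ Y) ≡ suc (sum (X ++ Y))
sum-insert X Y = begin
  sum (X ++ 1 ∷ Y)      ≡⟨ sum-++ X (1 ∷ Y) ⟩
  sum X + suc (sum Y)   ≡⟨ +-suc (sum X) (sum Y) ⟩
  suc (sum X + sum Y)   ≡⟨ cong suc (sum-++ X Y) ⟨
  suc (sum (X ++ Y))    ∎
  where open ≡-Reasoning

legs-leaf-↭ : ∀ a t X Y → a < t + sum X →
  legs a t (X ++ 1 ∷ Y) ↭ (skip (t + sum X) a , t + sum X) ∷ map (skipE (t + sum X)) (legs a t (X ++ Y))
legs-leaf-↭ a t X Y a<s = begin
  legs a t (X ++ 1 ∷ Y)
    ≡⟨ legs-++ a t X (1 ∷ Y) ⟩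
  legs a t X ++ (a , s) ∷ legs a (s + 1) Y
    ↭⟨ shift (a , s) (legs a t X) _ ⟩
  (a , s) ∷ legs a t X ++ legs a (s + 1) Y
    ≡⟨ cong₂ (λ x y → (x , s) ∷ legs a t X ++ legs a y Y) (sym (skip-< a<s)) (+-comm s 1) ⟩
  (skip s a , s) ∷ legs a t X ++ legs a (suc s) Y
    ≡⟨ cong ((skip s a , s) ∷_) shifted ⟨
  (skip s a , s) ∷ map (skipE s) (legs a t (X ++ Y))
    ∎
  where
  open PermutationReasoning
  s : ℕ
  s = t + sum X
  shifted : map (skipE s) (legs a t (X ++ Y)) ≡ legs a t X ++ legs a (suc s) Y
  shifted = trans (cong (map (skipE s)) (legs-++ a t X Y)) (trans (map-++ _ (legs a t X) _)
    (cong₂ _++_ (legs-skip-below a t X a<s ≤-refl) (legs-skip-above a s Y a<s ≤-refl)))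

dsEdges-rightLeaf-↭ : ∀ L c R₁ R₂ → let s = 2 + (c ∸ 1) + sum L + sum R₁ in
  dsEdges L c (R₁ ++ 1 ∷ R₂) ↭ (skip s v-r , s) ∷ map (skipE s) (dsEdges L c (R₁ ++ R₂))
dsEdges-rightLeaf-↭ L c R₁ R₂ = begin
  core ++ legsL ++ legs 1 T (R₁ ++ 1 ∷ R₂) ↭⟨ ++⁺ˡ core (++⁺ˡ legsL (legs-leaf-↭ 1 T R₁ R₂ 1<s)) ⟩
  core ++ legsL ++ e ∷ M′                  ↭⟨ ++⁺ˡ core (shift e legsL M′) ⟩
  core ++ e ∷ legsL ++ M′                  ↭⟨ shift e core _ ⟩
  e ∷ core ++ legsL ++ M′                  ≡⟨ cong (e ∷_) unchanged ⟨
  e ∷ map (skipE s) (core ++ legsL ++ legs 1 T (R₁ ++ R₂)) ∎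
  where
  open PermutationReasoning
  C T s : ℕ
  C = 2 + (c ∸ 1)
  T = C + sum L
  s = T + sum R₁
  core legsL M′ : List Edge
  core = pathTo 0 2 (c ∸ 1) 1
  legsL = legs 0 C L
  M′ = map (skipE s) (legs 1 T (R₁ ++ R₂))
  e : Edge
  e = skip s 1 , s
  T≤s : T ≤ s
  T≤s = m≤m+n T (sum R₁)
  C≤s : C ≤ s
  C≤s = ≤-trans (m≤m+n C (sum L)) T≤s
  1<s : 1 < s
  1<s = ≤-trans (m≤m+n 2 (c ∸ 1)) C≤s
  unchanged : map (skipE s) (core ++ legsL ++ legs 1 T (R₁ ++ R₂)) ≡ core ++ legsL ++ M′
  unchanged = trans (map-++ _ core _) (cong₂ _++_
    (pathTo-skip-below 0 2 (c ∸ 1) 1 (<-trans (s≤s z≤n) 1<s) 1<s C≤s)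
    (trans (map-++ _ legsL _) (cong (_++ M′) (legs-skip-below 0 C L (<-trans (s≤s z≤n) 1<s) T≤s))))

dsEdges-leftLeaf-↭ : ∀ L₁ L₂ c R → let s = 2 + (c ∸ 1) + sum L₁ in
  dsEdges (L₁ ++ 1 ∷ L₂) c R ↭ (skip s v-l , s) ∷ map (skipE s) (dsEdges (L₁ ++ L₂) c R)
dsEdges-leftLeaf-↭ L₁ L₂ c R = begin
  core ++ legs 0 C (L₁ ++ 1 ∷ L₂) ++ Q ↭⟨ ++⁺ˡ core (++⁺ʳ Q (legs-leaf-↭ 0 C L₁ L₂ 0<s)) ⟩
  core ++ e ∷ M′ ++ Q                  ↭⟨ shift e core _ ⟩
  e ∷ core ++ M′ ++ Q                  ≡⟨ cong (e ∷_) unchanged ⟨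
  e ∷ map (skipE s) (core ++ legs 0 C (L₁ ++ L₂) ++ legs 1 K′ R) ∎
  where
  open PermutationReasoning
  C s K′ : ℕ
  C = 2 + (c ∸ 1)
  s = C + sum L₁
  K′ = C + sum (L₁ ++ L₂)
  core M′ Q : List Edge
  core = pathTo 0 2 (c ∸ 1) 1
  M′ = map (skipE s) (legs 0 C (L₁ ++ L₂))
  Q = legs 1 (C + sum (L₁ ++ 1 ∷ L₂)) R
  e : Edge
  e = skip s 0 , s
  C≤s : C ≤ s
  C≤s = m≤m+n C (sum L₁)
  1<s : 1 < s
  1<s = ≤-trans (m≤m+n 2 (c ∸ 1)) C≤s
  0<s : 0 < s
  0<s = <-trans (s≤s z≤n) 1<s
  s≤K′ : s ≤ K′
  s≤K′ = +-monoʳ-≤ C (subst (sum L₁ ≤_) (sym (sum-++ L₁ L₂)) (m≤m+n (sum L₁) (sum L₂)))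
  unchanged : map (skipE s) (core ++ legs 0 C (L₁ ++ L₂) ++ legs 1 K′ R) ≡ core ++ M′ ++ Q
  unchanged = trans (map-++ _ core _) (cong₂ _++_
    (pathTo-skip-below 0 2 (c ∸ 1) 1 0<s 1<s C≤s)
    (trans (map-++ _ (legs 0 C (L₁ ++ L₂)) _) (cong (M′ ++_)
      (trans (legs-skip-above 1 K′ R 1<s s≤K′)
             (cong (λ x → legs 1 x R) (sym (trans (cong (C +_) (sum-insert L₁ L₂)) (+-suc C _))))))))

dsVertices-rightLeaf : ∀ L c R₁ R₂ → dsVertices L c (R₁ ++ 1 ∷ R₂) ≡ suc (dsVertices L c (R₁ ++ R₂))
dsVertices-rightLeaf L c R₁ R₂ =
  trans (cong (2 + (c ∸ 1) + sum L +_) (sum-insert R₁ R₂)) (+-suc (2 + (c ∸ 1) + sum L) (sum (R₁ ++ R₂)))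

dsVertices-leftLeaf : ∀ L₁ L₂ c R → dsVertices (L₁ ++ 1 ∷ L₂) c R ≡ suc (dsVertices (L₁ ++ L₂) c R)
dsVertices-leftLeaf L₁ L₂ c R =
  cong (_+ sum R) (trans (cong (2 + (c ∸ 1) +_) (sum-insert L₁ L₂)) (+-suc (2 + (c ∸ 1)) (sum (L₁ ++ L₂))))

dsEdges-φ-internal< : ∀ L c R {f} → IsStronglyAntimagicLabeling (dsVertices L c R) (dsEdges L c R) f
  → ∀ {w v} → w < dsVertices L c R → v < dsVertices L c R → w ≢ v-l → w ≢ v-r
  → 3 ≤ deg (dsEdges L c R) v → φ (dsEdges L c R) f w < φ (dsEdges L c R) f v
dsEdges-φ-internal< L c R am {w} {v} w<n v<n w≢0 w≢1 3≤dv =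
  proj₂ am w v w<n v<n (<-≤-trans (s≤s (dsEdges-deg≤2 L c R w≢0 w≢1)) 3≤dv)

sum-≤-++ : ∀ X Y → sum X ≤ sum (X ++ Y)
sum-≤-++ X Y = subst (sum X ≤_) (sym (sum-++ X Y)) (m≤m+n (sum X) (sum Y))

StronglyAntimagic-rightLeaf : ∀ L c R₁ R₂ →
  deg (dsEdges L c (R₁ ++ 1 ∷ R₂)) v-l ≥ deg (dsEdges L c (R₁ ++ 1 ∷ R₂)) v-r →
  deg (dsEdges L c (R₁ ++ 1 ∷ R₂)) v-r > 3 →
  StronglyAntimagic (dsVertices L c (R₁ ++ R₂)) (dsEdges L c (R₁ ++ R₂)) →
  StronglyAntimagic (dsVertices L c (R₁ ++ 1 ∷ R₂)) (dsEdges L c (R₁ ++ 1 ∷ R₂))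
StronglyAntimagic-rightLeaf L c R₁ R₂ dl≥dr dr>3 (f , am) =
  subst (λ n → StronglyAntimagic n G) (sym (dsVertices-rightLeaf L c R₁ R₂))
    (StronglyAntimagic-addLeaf f am s≤n 1<n (≤-trans (s≤s z≤n) dr′≥3) p-max G↭)
  where
  G G′ : List Edge
  G = dsEdges L c (R₁ ++ 1 ∷ R₂)
  G′ = dsEdges L c (R₁ ++ R₂)
  T s n : ℕ
  T = 2 + (c ∸ 1) + sum L
  s = T + sum R₁
  n = dsVertices L c (R₁ ++ R₂)
  G↭ : G ↭ (skip s v-r , s) ∷ map (skipE s) G′
  G↭ = dsEdges-rightLeaf-↭ L c R₁ R₂
  s≤n : s ≤ n
  s≤n = +-monoʳ-≤ T (sum-≤-++ R₁ R₂)
  1<s : 1 < s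
  1<s = ≤-trans (m≤m+n 2 _) (≤-trans (m≤m+n (2 + (c ∸ 1)) (sum L)) (m≤m+n T (sum R₁)))
  1<n : 1 < n
  1<n = <-≤-trans 1<s s≤n
  deg-v-r : deg G v-r ≡ suc (deg G′ v-r)
  deg-v-r = trans (deg-addLeaf {G′ = G′} {p = v-r} G↭ 1<s) (cong (_+ deg G′ v-r) (δ-refl v-r))
  deg-v-l : deg G v-l ≡ deg G′ v-l
  deg-v-l = trans (deg-addLeaf {G′ = G′} {p = v-r} G↭ (<-trans (s≤s z≤n) 1<s))
                  (cong (_+ deg G′ v-l) (δ-≢ {v-r} {v-l} λ ()))
  dr′≥3 : 3 ≤ deg G′ v-r
  dr′≥3 = ≤-pred (subst (3 <_) deg-v-r dr>3)
  dr′<dl′ : deg G′ v-r < deg G′ v-l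
  dr′<dl′ = subst₂ _≤_ deg-v-r deg-v-l dl≥dr
  p-max : ∀ w → w < n → w ≢ v-r → deg G′ w ≤ deg G′ v-r → φ G′ f w < φ G′ f v-r
  p-max w w<n w≢1 dw≤dr with toSum (w ≟ v-l)
  ... | inj₁ refl = contradiction dw≤dr (<⇒≱ dr′<dl′)
  ... | inj₂ w≢0  = dsEdges-φ-internal< L c (R₁ ++ R₂) {f} am w<n 1<n w≢0 w≢1 dr′≥3

StronglyAntimagic-leftLeaf : ∀ L₁ L₂ c R →
  deg (dsEdges (L₁ ++ 1 ∷ L₂) c R) v-l > deg (dsEdges (L₁ ++ 1 ∷ L₂) c R) v-r →
  deg (dsEdges (L₁ ++ 1 ∷ L₂) c R) v-r ≥ 3 →
  (f : EdgeIx (dsEdges (L₁ ++ L₂) c R) ⤖ EdgeIx (dsEdges (L₁ ++ L₂) c R)) →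
  IsStronglyAntimagicLabeling (dsVertices (L₁ ++ L₂) c R) (dsEdges (L₁ ++ L₂) c R) f →
  φ (dsEdges (L₁ ++ L₂) c R) f v-l > φ (dsEdges (L₁ ++ L₂) c R) f v-r →
  StronglyAntimagic (dsVertices (L₁ ++ 1 ∷ L₂) c R) (dsEdges (L₁ ++ 1 ∷ L₂) c R)
StronglyAntimagic-leftLeaf L₁ L₂ c R dl>dr dr≥3 f am φl>φr =
  subst (λ n → StronglyAntimagic n G) (sym (dsVertices-leftLeaf L₁ L₂ c R))
    (StronglyAntimagic-addLeaf f am s≤n 0<n (≤-trans (s≤s z≤n) dl′≥3) p-max G↭)
  where
  G G′ : List Edge
  G = dsEdges (L₁ ++ 1 ∷ L₂) c R
  G′ = dsEdges (L₁ ++ L₂) c R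
  C s n : ℕ
  C = 2 + (c ∸ 1)
  s = C + sum L₁
  n = dsVertices (L₁ ++ L₂) c R
  G↭ : G ↭ (skip s v-l , s) ∷ map (skipE s) G′
  G↭ = dsEdges-leftLeaf-↭ L₁ L₂ c R
  s≤n : s ≤ n
  s≤n = ≤-trans (+-monoʳ-≤ C (sum-≤-++ L₁ L₂)) (m≤m+n _ (sum R))
  1<s : 1 < s
  1<s = ≤-trans (m≤m+n 2 _) (m≤m+n C (sum L₁))
  0<n : 0 < n
  0<n = <-≤-trans (<-trans (s≤s z≤n) 1<s) s≤n
  deg-v-l : deg G v-l ≡ suc (deg G′ v-l)
  deg-v-l = trans (deg-addLeaf {G′ = G′} {p = v-l} G↭ (<-trans (s≤s z≤n) 1<s))
                  (cong (_+ deg G′ v-l) (δ-refl v-l))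
  deg-v-r : deg G v-r ≡ deg G′ v-r
  deg-v-r = trans (deg-addLeaf {G′ = G′} {p = v-l} G↭ 1<s) (cong (_+ deg G′ v-r) (δ-≢ {v-l} {v-r} λ ()))
  dr′≥3 : 3 ≤ deg G′ v-r
  dr′≥3 = subst (3 ≤_) deg-v-r dr≥3
  dl′≥3 : 3 ≤ deg G′ v-l
  dl′≥3 = ≤-trans dr′≥3 (≤-pred (subst₂ _<_ deg-v-r deg-v-l dl>dr))
  p-max : ∀ w → w < n → w ≢ v-l → deg G′ w ≤ deg G′ v-l → φ G′ f w < φ G′ f v-l
  p-max w w<n w≢0 dw≤dl with toSum (w ≟ v-r)
  ... | inj₁ refl = φl>φr
  ... | inj₂ w≢1  = dsEdges-φ-internal< (L₁ ++ L₂) c R {f} am w<n 0<n w≢0 w≢1 dl′≥3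

lemma3 : (L : List ℕ) (c : ℕ) (R : List ℕ) → IsDoubleSpider L c R →
    ((Σ (List ℕ) λ R₁ → Σ (List ℕ) λ R₂ → R ≡ R₁ ++ (1 ∷ R₂)
        × deg (dsEdges L c R) v-l ≥ deg (dsEdges L c R) v-r
        × deg (dsEdges L c R) v-r > 3
        × StronglyAntimagic (dsVertices L c (R₁ ++ R₂)) (dsEdges L c (R₁ ++ R₂)))
    ⊎ (Σ (List ℕ) λ L₁ → Σ (List ℕ) λ L₂ → L ≡ L₁ ++ (1 ∷ L₂)
        × deg (dsEdges L c R) v-l > deg (dsEdges L c R) v-r
        × deg (dsEdges L c R) v-r ≥ 3
        × Σ (EdgeIx (dsEdges (L₁ ++ L₂) c R) ⤖ EdgeIx (dsEdges (L₁ ++ L₂) c R)) λ f →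
            IsStronglyAntimagicLabeling (dsVertices (L₁ ++ L₂) c R) (dsEdges (L₁ ++ L₂) c R) f
            × φ (dsEdges (L₁ ++ L₂) c R) f v-l > φ (dsEdges (L₁ ++ L₂) c R) f v-r)) →
    StronglyAntimagic (dsVertices L c R) (dsEdges L c R)
lemma3 L c R _ (inj₁ (R₁ , R₂ , refl , dl≥dr , dr>3 , am)) = StronglyAntimagic-rightLeaf L c R₁ R₂ dl≥dr dr>3 am
lemma3 L c R _ (inj₂ (L₁ , L₂ , refl , dl>dr , dr≥3 , f , am , φl>φr)) = StronglyAntimagic-leftLeaf L₁ L₂ c R dl>dr dr≥3 f am φl>φr
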